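{- Let $(u_n)_{n \geq 1}$ be an increasing arithmetic sequence of positive integers with common difference $r$. Then for every positive integer $k$, $$\sum_{n=1}^{+\infty} \frac{(-1)^{(r-1)(n-1)}}{F_{u_n} F_{u_{n+2k}}} = \frac{F_r}{F_{2kr}} \sum_{n=1}^{k} \frac{1}{F_{u_{2n}} F_{u_{2n-1}}}.$$ In particular, $$\sum_{n=1}^{+\infty} \frac{(-1)^{(r-1)(n-1)}}{F_{u_n} F_{u_{n+2}}} = \frac{1}{F_{u_1} F_{u_2} L_r}.$$
   Context: $(F_n)$ is the Fibonacci sequence: $F_0 = 0$, $F_1 = 1$, $F_{n+2} = F_{n+1} + F_n$. $(L_n)$ is the Lucas sequence: $L_0 = 2$, $L_1 = 1$, $L_{n+2} = L_{n+1} + L_n$. -}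

module Defs where

open import Data.Nat using (ℕ; zero; suc; _+_; _*_; _∸_; _≤_)
open import Data.Integer as ℤ using (ℤ; +_; -[1+_])
open import Data.Rational as ℚ using (ℚ; 0ℚ; _<_)
open import Data.Product using (∃)

fib : ℕ → ℕ
fib 0 = 0
fib 1 = 1
fib (suc (suc n)) = fib (suc n) + fib n

lucas : ℕ → ℕ
lucas 0 = 2
lucas 1 = 1
lucas (suc (suc n)) = lucas (suc n) + lucas n

-- p / d as a rational; total version (value 0 when d = 0).
-- Only ever applied to nonzero denominators in the statement (under its hypotheses).
divℚ : ℤ → ℕ → ℚ
divℚ p zero = 0ℚ
divℚ p (suc d) = p ℚ./ suc d

negOnePow : ℕ → ℤ
negOnePow m = -[1+ 0 ] ℤ.^ m

sum1 : (ℕ → ℚ) → ℕ → ℚ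
sum1 f zero = 0ℚ
sum1 f (suc N) = sum1 f N ℚ.+ f (suc N)

-- The series sum_{n=1}^{∞} f n converges (in ℚ, hence in ℝ) to L:
-- for every rational ε > 0 there is N with |S_m - L| < ε for all m ≥ N.
SeriesSumsTo : (ℕ → ℚ) → ℚ → Set
SeriesSumsTo f L =
  ∀ (ε : ℚ) → 0ℚ < ε → ∃ λ N → ∀ m → N ≤ m → ℚ.∣ sum1 f m ℚ.- L ∣ < ε

-- Write x m = u (m + 1) = u 1 + m r and ρ m = F (x (m + 1)) / F (x m). Vajda's identity
-- F (i + n) F (j + n) - F n F (i + j + n) = (-1)^n F i F j turns each gap ρ m - ρ (m + s) into
-- (-1)^(x m) F r F (s r) / (F (x m) F (x (m + s))). With G m = (-1)^(u 1 + m) ρ m / (F r F (2 k r)),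
-- the (m + 1)-st term of the series is therefore G m - G (m + 2 k), so the N-th partial sum telescopes
-- to a sum of 2 k values of G minus a sum of 2 k values of G starting at N. Grouping these in
-- consecutive pairs (the gap with s = 1) turns the first sum into the claimed constant and bounds
-- the second by k F r / (N + 1). For k = 1 the constant simplifies by F (2 r) = F r L r.
module Submission where

open import Defs
open import Data.Nat using (ℕ; suc; _+_; _*_; _∸_; _≤_)
open import Data.Integer using (+_)
open import Data.Rational using () renaming (_*_ to _*ℚ_)
open import Data.Product using (_×_)
open import Data.Product using (∃; _,_)
open import Relation.Binary.PropositionalEquality using (_≡_)

open import Data.Nat using (zero; _<_; _≤′_; ≤′-refl; ≤′-step; z≤n; s≤s; >-nonZero)
import Data.Nat.Properties as ℕ
open import Data.Integer as ℤ using (ℤ; -[1+_])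
import Data.Integer.Properties as ℤ
import Data.Integer.Tactic.RingSolver as ℤ-Ring
import Data.Nat.Tactic.RingSolver as ℕ-Ring
open import Data.Rational as ℚ using (ℚ; 0ℚ; 1ℚ; toℚᵘ; ∣_∣)
  renaming (_+_ to _+ℚ_; _-_ to _-ℚ_; -_ to -ℚ_; _≤_ to _≤ℚ_; _<_ to _<ℚ_)
import Data.Rational.Properties as ℚ
open import Data.Rational.Literals using (fromℤ)
open import Data.Rational.Unnormalised as ℚᵘ using (mkℚᵘ; *≡*; *≤*; *<*)
import Data.Rational.Unnormalised.Properties as ℚᵘ
open import Level using (0ℓ)
open import Relation.Nullary.Decidable using (dec⇒maybe)
open import Relation.Binary.PropositionalEquality using (refl; sym; trans; cong; cong₂; subst; subst₂; module ≡-Reasoning)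
import Tactic.RingSolver as Ring
open import Tactic.RingSolver.Core.AlmostCommutativeRing using (AlmostCommutativeRing; fromCommutativeRing)

-- Fibonacci and Lucas numbers

fib[n]≤fib[1+n] : ∀ n → fib n ≤ fib (suc n)
fib[n]≤fib[1+n] zero = z≤n
fib[n]≤fib[1+n] (suc zero) = s≤s z≤n
fib[n]≤fib[1+n] (suc (suc n)) = ℕ.m≤m+n (fib (suc (suc n))) (fib (suc n))

fib-mono-≤ : ∀ {m n} → m ≤ n → fib m ≤ fib n
fib-mono-≤ {m} m≤n = go (ℕ.≤⇒≤′ m≤n)
  where
  go : ∀ {n} → m ≤′ n → fib m ≤ fib n
  go ≤′-refl = ℕ.≤-refl
  go (≤′-step {n} m≤′n) = ℕ.≤-trans (go m≤′n) (fib[n]≤fib[1+n] n)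

fib-pos : ∀ {n} → 0 < n → 0 < fib n
fib-pos = fib-mono-≤

n≤fib[n]*fib[1+n] : ∀ n → n ≤ fib n * fib (suc n)
n≤fib[n]*fib[1+n] zero = z≤n
n≤fib[n]*fib[1+n] (suc n) = begin
  1 + n                                           ≤⟨ ℕ.+-mono-≤ (ℕ.*-mono-< 0<F 0<F) (n≤fib[n]*fib[1+n] n) ⟩
  fib (suc n) * fib (suc n) + fib n * fib (suc n) ≡⟨ factor (fib (suc n)) (fib n) ⟩
  fib (suc n) * fib (suc (suc n))                 ∎
  where
  open ℕ.≤-Reasoning
  0<F : 0 < fib (suc n)
  0<F = fib-pos {suc n} (s≤s z≤n)
  factor : ∀ a b → a * a + b * a ≡ a * (a + b)
  factor = ℕ-Ring.solve-∀

fib-+ : ∀ m n → fib (suc (m + n)) ≡ fib (suc m) * fib (suc n) + fib m * fib n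
fib-+ zero n = sym (trans (ℕ.+-identityʳ _) (ℕ.+-identityʳ (fib (suc n))))
fib-+ (suc zero) n = sym (cong₂ _+_ (ℕ.+-identityʳ (fib (suc n))) (ℕ.+-identityʳ (fib n)))
fib-+ (suc (suc m)) n = begin
  fib (suc (suc m + n)) + fib (suc (m + n))
    ≡⟨ cong₂ _+_ (fib-+ (suc m) n) (fib-+ m n) ⟩
  (fib (suc (suc m)) * fib (suc n) + fib (suc m) * fib n) + (fib (suc m) * fib (suc n) + fib m * fib n)
    ≡⟨ regroup (fib (suc (suc m))) (fib (suc m)) (fib m) (fib (suc n)) (fib n) ⟩
  (fib (suc (suc m)) + fib (suc m)) * fib (suc n) + (fib (suc m) + fib m) * fib n
    ∎
  where
  open ≡-Reasoning
  regroup : ∀ a b c p q → (a * p + b * q) + (b * p + c * q) ≡ (a + b) * p + (b + c) * q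
  regroup = ℕ-Ring.solve-∀

lucas[1+n]≡fib[2+n]+fib[n] : ∀ n → lucas (suc n) ≡ fib (suc (suc n)) + fib n
lucas[1+n]≡fib[2+n]+fib[n] zero = refl
lucas[1+n]≡fib[2+n]+fib[n] (suc zero) = refl
lucas[1+n]≡fib[2+n]+fib[n] (suc (suc n)) = begin
  lucas (suc (suc n)) + lucas (suc n)
    ≡⟨ cong₂ _+_ (lucas[1+n]≡fib[2+n]+fib[n] (suc n)) (lucas[1+n]≡fib[2+n]+fib[n] n) ⟩
  (fib (suc (suc (suc n))) + fib (suc n)) + (fib (suc (suc n)) + fib n)
    ≡⟨ interchange (fib (suc (suc (suc n)))) (fib (suc n)) (fib (suc (suc n))) (fib n) ⟩
  (fib (suc (suc (suc n))) + fib (suc (suc n))) + (fib (suc n) + fib n)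
    ∎
  where
  open ≡-Reasoning
  interchange : ∀ a b c d → (a + b) + (c + d) ≡ (a + c) + (b + d)
  interchange = ℕ-Ring.solve-∀

fib[2n]≡fib[n]*lucas[n] : ∀ n → fib (2 * n) ≡ fib n * lucas n
fib[2n]≡fib[n]*lucas[n] zero = refl
fib[2n]≡fib[n]*lucas[n] (suc n) = begin
  fib (2 * suc n)                                   ≡⟨ cong fib (ℕ.+-suc (suc n) (n + 0)) ⟩
  fib (suc (suc n + (n + 0)))                       ≡⟨ cong (λ m → fib (suc (suc n + m))) (ℕ.+-identityʳ n) ⟩
  fib (suc (suc n + n))                             ≡⟨ fib-+ (suc n) n ⟩
  fib (suc (suc n)) * fib (suc n) + fib (suc n) * fib n ≡⟨ factor (fib (suc (suc n))) (fib (suc n)) (fib n) ⟩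
  fib (suc n) * (fib (suc (suc n)) + fib n)         ≡⟨ cong (fib (suc n) *_) (sym (lucas[1+n]≡fib[2+n]+fib[n] n)) ⟩
  fib (suc n) * lucas (suc n)                       ∎
  where
  open ≡-Reasoning
  factor : ∀ a b c → a * b + b * c ≡ b * (a + c)
  factor = ℕ-Ring.solve-∀

fib-vajda-1 : ∀ y τ →
  + fib (suc y) ℤ.* + fib (y + τ) ℤ.- + fib y ℤ.* + fib (suc (y + τ)) ≡ negOnePow y ℤ.* + fib τ
fib-vajda-1 zero τ = base (+ fib τ) (+ fib (suc τ))
  where
  base : ∀ a b → + 1 ℤ.* a ℤ.- + 0 ℤ.* b ≡ + 1 ℤ.* a
  base = ℤ-Ring.solve-∀
fib-vajda-1 (suc y) τ = begin
  (b ℤ.+ a) ℤ.* Q ℤ.- b ℤ.* (Q ℤ.+ P)     ≡⟨ sign-flip a b P Q ⟩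
  -[1+ 0 ] ℤ.* (b ℤ.* P ℤ.- a ℤ.* Q)      ≡⟨ cong (-[1+ 0 ] ℤ.*_) (fib-vajda-1 y τ) ⟩
  -[1+ 0 ] ℤ.* (negOnePow y ℤ.* + fib τ)  ≡⟨ sym (ℤ.*-assoc -[1+ 0 ] (negOnePow y) (+ fib τ)) ⟩
  negOnePow (suc y) ℤ.* + fib τ           ∎
  where
  open ≡-Reasoning
  a b P Q : ℤ
  a = + fib y
  b = + fib (suc y)
  P = + fib (y + τ)
  Q = + fib (suc (y + τ))
  sign-flip : ∀ a b P Q → (b ℤ.+ a) ℤ.* Q ℤ.- b ℤ.* (Q ℤ.+ P) ≡ -[1+ 0 ] ℤ.* (b ℤ.* P ℤ.- a ℤ.* Q)
  sign-flip = ℤ-Ring.solve-∀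

fib-vajda : ∀ ρ τ y →
  + fib (ρ + y) ℤ.* + fib (τ + y) ℤ.- + fib y ℤ.* + fib (ρ + (τ + y)) ≡ negOnePow y ℤ.* + fib ρ ℤ.* + fib τ
fib-vajda zero τ y = cancel (+ fib y) (+ fib (τ + y)) (negOnePow y) (+ fib τ)
  where
  cancel : ∀ a b s c → a ℤ.* b ℤ.- a ℤ.* b ≡ s ℤ.* + 0 ℤ.* c
  cancel = ℤ-Ring.solve-∀
fib-vajda (suc zero) τ y rewrite ℕ.+-comm τ y =
  trans (fib-vajda-1 y τ) (cong (ℤ._* + fib τ) (sym (ℤ.*-identityʳ (negOnePow y))))
fib-vajda (suc (suc ρ)) τ y = begin
  (A ℤ.+ B) ℤ.* C ℤ.- f ℤ.* (X ℤ.+ Y)             ≡⟨ split A B C f X Y ⟩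
  (A ℤ.* C ℤ.- f ℤ.* X) ℤ.+ (B ℤ.* C ℤ.- f ℤ.* Y) ≡⟨ cong₂ ℤ._+_ (fib-vajda (suc ρ) τ y) (fib-vajda ρ τ y) ⟩
  s ℤ.* + fib (suc ρ) ℤ.* t ℤ.+ s ℤ.* + fib ρ ℤ.* t ≡⟨ merge s (+ fib (suc ρ)) (+ fib ρ) t ⟩
  s ℤ.* + fib (suc (suc ρ)) ℤ.* t                 ∎
  where
  open ≡-Reasoning
  A B C f X Y s t : ℤ
  A = + fib (suc ρ + y)
  B = + fib (ρ + y)
  C = + fib (τ + y)
  f = + fib y
  X = + fib (suc ρ + (τ + y))
  Y = + fib (ρ + (τ + y))
  s = negOnePow y
  t = + fib τ
  split : ∀ A B C f X Y → (A ℤ.+ B) ℤ.* C ℤ.- f ℤ.* (X ℤ.+ Y) ≡ (A ℤ.* C ℤ.- f ℤ.* X) ℤ.+ (B ℤ.* C ℤ.- f ℤ.* Y)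
  split = ℤ-Ring.solve-∀
  merge : ∀ s p q t → s ℤ.* p ℤ.* t ℤ.+ s ℤ.* q ℤ.* t ≡ s ℤ.* (p ℤ.+ q) ℤ.* t
  merge = ℤ-Ring.solve-∀

-- Rational embedding, signs and reciprocals

ℚ-ring : AlmostCommutativeRing 0ℓ 0ℓ
ℚ-ring = fromCommutativeRing ℚ.+-*-commutativeRing (λ p → dec⇒maybe (0ℚ ℚ.≟ p))

fromℤ-homo-+ : ∀ i j → fromℤ (i ℤ.+ j) ≡ fromℤ i +ℚ fromℤ j
fromℤ-homo-+ i j = ℚ.toℚᵘ-injective (ℚᵘ.≃-sym (ℚᵘ.≃-trans
  (ℚ.toℚᵘ-homo-+ (fromℤ i) (fromℤ j)) (*≡* (identity i j))))
  where
  identity : ∀ i j → (i ℤ.* + 1 ℤ.+ j ℤ.* + 1) ℤ.* + 1 ≡ (i ℤ.+ j) ℤ.* (+ 1 ℤ.* + 1)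
  identity = ℤ-Ring.solve-∀

fromℤ-homo-* : ∀ i j → fromℤ (i ℤ.* j) ≡ fromℤ i *ℚ fromℤ j
fromℤ-homo-* i j = ℚ.toℚᵘ-injective (ℚᵘ.≃-sym (ℚᵘ.≃-trans
  (ℚ.toℚᵘ-homo-* (fromℤ i) (fromℤ j)) (*≡* (identity i j))))
  where
  identity : ∀ i j → i ℤ.* j ℤ.* + 1 ≡ i ℤ.* j ℤ.* (+ 1 ℤ.* + 1)
  identity = ℤ-Ring.solve-∀

fromℤ-homo‿- : ∀ i → fromℤ (ℤ.- i) ≡ -ℚ fromℤ i
fromℤ-homo‿- (+ zero) = refl
fromℤ-homo‿- (+ suc n) = refl
fromℤ-homo‿- -[1+ n ] = refl

fibℚ : ℕ → ℚ
fibℚ n = fromℤ (+ fib n)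

sign : ℕ → ℚ
sign n = fromℤ (negOnePow n)

fibℚ-vajda : ∀ ρ τ y →
  fibℚ (ρ + y) *ℚ fibℚ (τ + y) -ℚ fibℚ y *ℚ fibℚ (ρ + (τ + y)) ≡ sign y *ℚ fibℚ ρ *ℚ fibℚ τ
fibℚ-vajda ρ τ y = begin
  fibℚ (ρ + y) *ℚ fibℚ (τ + y) -ℚ fibℚ y *ℚ fibℚ (ρ + (τ + y))
    ≡⟨ cong₂ _-ℚ_ (sym (fromℤ-homo-* (+ fib (ρ + y)) (+ fib (τ + y)))) (sym (fromℤ-homo-* (+ fib y) (+ fib (ρ + (τ + y))))) ⟩
  fromℤ A -ℚ fromℤ B     ≡⟨ cong (fromℤ A +ℚ_) (sym (fromℤ-homo‿- B)) ⟩
  fromℤ A +ℚ fromℤ (ℤ.- B) ≡⟨ sym (fromℤ-homo-+ A (ℤ.- B)) ⟩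
  fromℤ (A ℤ.- B)        ≡⟨ cong fromℤ (fib-vajda ρ τ y) ⟩
  fromℤ (negOnePow y ℤ.* + fib ρ ℤ.* + fib τ)
    ≡⟨ trans (fromℤ-homo-* (negOnePow y ℤ.* + fib ρ) (+ fib τ)) (cong (_*ℚ fibℚ τ) (fromℤ-homo-* (negOnePow y) (+ fib ρ))) ⟩
  sign y *ℚ fibℚ ρ *ℚ fibℚ τ ∎
  where
  open ≡-Reasoning
  A B : ℤ
  A = + fib (ρ + y) ℤ.* + fib (τ + y)
  B = + fib y ℤ.* + fib (ρ + (τ + y))

sign-+ : ∀ m n → sign (m + n) ≡ sign m *ℚ sign n
sign-+ m n = trans (cong fromℤ (ℤ.^-distribˡ-+-* -[1+ 0 ] m n)) (fromℤ-homo-* (negOnePow m) (negOnePow n))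

sign-suc : ∀ n → sign (suc n) ≡ -ℚ sign n
sign-suc n = trans (cong fromℤ (ℤ.-1*i≡-i (negOnePow n))) (fromℤ-homo‿- (negOnePow n))

sign-2* : ∀ n → sign (2 * n) ≡ 1ℚ
sign-2* n = cong fromℤ (trans (sym (ℤ.^-*-assoc -[1+ 0 ] 2 n)) (ℤ.^-zeroˡ n))

sign-+-2* : ∀ m n → sign (m + 2 * n) ≡ sign m
sign-+-2* m n = trans (sign-+ m (2 * n)) (trans (cong (sign m *ℚ_) (sign-2* n)) (ℚ.*-identityʳ (sign m)))

∣sign∣≡1 : ∀ n → ∣ sign n ∣ ≡ 1ℚ
∣sign∣≡1 zero = refl
∣sign∣≡1 (suc n) = trans (cong ∣_∣ (sign-suc n)) (trans (ℚ.∣-p∣≡∣p∣ (sign n)) (∣sign∣≡1 n))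

recip : ℕ → ℚ
recip n = divℚ (+ 1) n

toℚᵘ-divℚ : ∀ p d → toℚᵘ (divℚ p (suc d)) ℚᵘ.≃ mkℚᵘ p d
toℚᵘ-divℚ p d = ℚ.toℚᵘ-fromℚᵘ (mkℚᵘ p d)

divℚ≡fromℤ*recip : ∀ p d → divℚ p d ≡ fromℤ p *ℚ recip d
divℚ≡fromℤ*recip p zero = sym (ℚ.*-zeroʳ (fromℤ p))
divℚ≡fromℤ*recip p (suc d) = ℚ.toℚᵘ-injective (begin
  toℚᵘ (divℚ p (suc d))                          ≈⟨ toℚᵘ-divℚ p d ⟩
  mkℚᵘ p d                                        ≈⟨ *≡* (identity p (+ suc d)) ⟩
  mkℚᵘ p 0 ℚᵘ.* mkℚᵘ (+ 1) d                      ≈⟨ ℚᵘ.*-congˡ {mkℚᵘ p 0} (ℚᵘ.≃-sym (toℚᵘ-divℚ (+ 1) d)) ⟩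
  toℚᵘ (fromℤ p) ℚᵘ.* toℚᵘ (recip (suc d))        ≈⟨ ℚᵘ.≃-sym (ℚ.toℚᵘ-homo-* (fromℤ p) (recip (suc d))) ⟩
  toℚᵘ (fromℤ p *ℚ recip (suc d))                 ∎)
  where
  open ℚᵘ.≃-Reasoning
  identity : ∀ p q → p ℤ.* (+ 1 ℤ.* q) ≡ (p ℤ.* + 1) ℤ.* q
  identity = ℤ-Ring.solve-∀

-- Unconditional because of the junk value recip 0 = 0.
recip-* : ∀ m n → recip (m * n) ≡ recip m *ℚ recip n
recip-* zero n = sym (ℚ.*-zeroˡ (recip n))
recip-* (suc m) zero = trans (cong recip (ℕ.*-zeroʳ (suc m))) (sym (ℚ.*-zeroʳ (recip (suc m))))
recip-* (suc m) (suc n) = ℚ.toℚᵘ-injective (begin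
  toℚᵘ (recip (suc m * suc n))                    ≈⟨ toℚᵘ-divℚ (+ 1) (n + m * suc n) ⟩
  mkℚᵘ (+ 1) (n + m * suc n)                      ≈⟨ *≡* (identity (+ suc m) (+ suc n)) ⟩
  mkℚᵘ (+ 1) m ℚᵘ.* mkℚᵘ (+ 1) n                  ≈⟨ ℚᵘ.≃-sym (ℚᵘ.*-cong (toℚᵘ-divℚ (+ 1) m) (toℚᵘ-divℚ (+ 1) n)) ⟩
  toℚᵘ (recip (suc m)) ℚᵘ.* toℚᵘ (recip (suc n))  ≈⟨ ℚᵘ.≃-sym (ℚ.toℚᵘ-homo-* (recip (suc m)) (recip (suc n))) ⟩
  toℚᵘ (recip (suc m) *ℚ recip (suc n))           ∎)
  where
  open ℚᵘ.≃-Reasoning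
  identity : ∀ a b → + 1 ℤ.* (a ℤ.* b) ≡ (+ 1 ℤ.* + 1) ℤ.* (a ℤ.* b)
  identity = ℤ-Ring.solve-∀

fromℤ-*-recip : ∀ {n} → 0 < n → fromℤ (+ n) *ℚ recip n ≡ 1ℚ
fromℤ-*-recip {suc d} _ = ℚ.toℚᵘ-injective (begin
  toℚᵘ (fromℤ (+ suc d) *ℚ recip (suc d))        ≈⟨ ℚ.toℚᵘ-homo-* (fromℤ (+ suc d)) (recip (suc d)) ⟩
  mkℚᵘ (+ suc d) 0 ℚᵘ.* toℚᵘ (recip (suc d))      ≈⟨ ℚᵘ.*-congˡ {mkℚᵘ (+ suc d) 0} (toℚᵘ-divℚ (+ 1) d) ⟩
  mkℚᵘ (+ suc d) 0 ℚᵘ.* mkℚᵘ (+ 1) d              ≈⟨ *≡* (identity (+ suc d)) ⟩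
  toℚᵘ 1ℚ                                         ∎)
  where
  open ℚᵘ.≃-Reasoning
  identity : ∀ a → a ℤ.* + 1 ℤ.* + 1 ≡ + 1 ℤ.* (+ 1 ℤ.* a)
  identity = ℤ-Ring.solve-∀

divℚ-nonNeg : ∀ p d → 0ℚ ≤ℚ divℚ (+ p) d
divℚ-nonNeg p zero = ℚ.≤-refl
divℚ-nonNeg p (suc d) = ℚ.nonNegative⁻¹ (divℚ (+ p) (suc d)) {{ℚ.normalize-nonNeg p (suc d)}}

divℚ-antimono-≤ : ∀ p {d d′} → 0 < d′ → d′ ≤ d → divℚ (+ p) d ≤ℚ divℚ (+ p) d′
divℚ-antimono-≤ p {suc d} {suc d′} _ d′≤d = ℚ.toℚᵘ-cancel-≤
  (ℚᵘ.≤-respˡ-≃ (ℚᵘ.≃-sym (toℚᵘ-divℚ (+ p) d)) (ℚᵘ.≤-respʳ-≃ (ℚᵘ.≃-sym (toℚᵘ-divℚ (+ p) d′))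
    (*≤* (ℤ.*-monoˡ-≤-nonNeg (+ p) (ℤ.+≤+ d′≤d)))))

-- With ε = n / d and n ≥ 1, the bound N₀ = c d suffices: c d < N + 1 ≤ n (N + 1).
archimedean-divℚ : ∀ c ε → 0ℚ <ℚ ε → ∃ λ N₀ → ∀ N → N₀ ≤ N → divℚ (+ c) (suc N) <ℚ ε
archimedean-divℚ c (ℚ.mkℚ (+ zero) d _) (ℚ.*<* (ℤ.+<+ ()))
archimedean-divℚ c (ℚ.mkℚ -[1+ n ] d _) (ℚ.*<* ())
archimedean-divℚ c (ℚ.mkℚ (+ suc n) d _) _ = c * suc d , λ N N₀≤N →
  ℚ.toℚᵘ-cancel-< (ℚᵘ.<-respˡ-≃ (ℚᵘ.≃-sym (toℚᵘ-divℚ (+ c) N))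
    (*<* (subst₂ ℤ._<_ (ℤ.pos-* c (suc d)) (ℤ.pos-* (suc n) (suc N))
      (ℤ.+<+ (ℕ.≤-trans (s≤s N₀≤N) (ℕ.m≤n*m (suc N) (suc n)))))))

sub-fractions : ∀ α β p p′ q q′ → p *ℚ p′ ≡ 1ℚ → q *ℚ q′ ≡ 1ℚ →
  α *ℚ p′ -ℚ β *ℚ q′ ≡ (α *ℚ q -ℚ p *ℚ β) *ℚ (p′ *ℚ q′)
sub-fractions α β p p′ q q′ pp′≡1 qq′≡1 = begin
  α *ℚ p′ -ℚ β *ℚ q′                             ≡⟨ cong₂ _-ℚ_ (sym (ℚ.*-identityʳ (α *ℚ p′))) (sym (ℚ.*-identityʳ (β *ℚ q′))) ⟩
  α *ℚ p′ *ℚ 1ℚ -ℚ β *ℚ q′ *ℚ 1ℚ                 ≡⟨ cong₂ (λ u v → α *ℚ p′ *ℚ u -ℚ β *ℚ q′ *ℚ v) (sym qq′≡1) (sym pp′≡1) ⟩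
  α *ℚ p′ *ℚ (q *ℚ q′) -ℚ β *ℚ q′ *ℚ (p *ℚ p′)   ≡⟨ regroup α β p p′ q q′ ⟩
  (α *ℚ q -ℚ p *ℚ β) *ℚ (p′ *ℚ q′)               ∎
  where
  open ≡-Reasoning
  regroup : ∀ α β p p′ q q′ → α *ℚ p′ *ℚ (q *ℚ q′) -ℚ β *ℚ q′ *ℚ (p *ℚ p′) ≡ (α *ℚ q -ℚ p *ℚ β) *ℚ (p′ *ℚ q′)
  regroup = Ring.solve-∀ ℚ-ring

fromℤ-*-divℚ : ∀ i j d → fromℤ i *ℚ divℚ j d ≡ divℚ (i ℤ.* j) d
fromℤ-*-divℚ i j d = begin
  fromℤ i *ℚ divℚ j d               ≡⟨ cong (fromℤ i *ℚ_) (divℚ≡fromℤ*recip j d) ⟩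
  fromℤ i *ℚ (fromℤ j *ℚ recip d)   ≡⟨ sym (ℚ.*-assoc (fromℤ i) (fromℤ j) (recip d)) ⟩
  fromℤ i *ℚ fromℤ j *ℚ recip d     ≡⟨ cong (_*ℚ recip d) (sym (fromℤ-homo-* i j)) ⟩
  fromℤ (i ℤ.* j) *ℚ recip d        ≡⟨ sym (divℚ≡fromℤ*recip (i ℤ.* j) d) ⟩
  divℚ (i ℤ.* j) d                  ∎
  where open ≡-Reasoning

divℚ-cancelˡ : ∀ {n} m → 0 < n → divℚ (+ n) (n * m) ≡ recip m
divℚ-cancelˡ {n} m 0<n = begin
  divℚ (+ n) (n * m)                    ≡⟨ divℚ≡fromℤ*recip (+ n) (n * m) ⟩
  fromℤ (+ n) *ℚ recip (n * m)          ≡⟨ cong (fromℤ (+ n) *ℚ_) (recip-* n m) ⟩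
  fromℤ (+ n) *ℚ (recip n *ℚ recip m)   ≡⟨ sym (ℚ.*-assoc (fromℤ (+ n)) (recip n) (recip m)) ⟩
  fromℤ (+ n) *ℚ recip n *ℚ recip m     ≡⟨ cong (_*ℚ recip m) (fromℤ-*-recip 0<n) ⟩
  1ℚ *ℚ recip m                         ≡⟨ ℚ.*-identityˡ (recip m) ⟩
  recip m                               ∎
  where open ≡-Reasoning

divℚ[fib[n],fib[2n]]≡recip[lucas[n]] : ∀ {n} → 0 < n → divℚ (+ fib n) (fib (2 * n)) ≡ recip (lucas n)
divℚ[fib[n],fib[2n]]≡recip[lucas[n]] {n} 0<n =
  trans (cong (divℚ (+ fib n)) (fib[2n]≡fib[n]*lucas[n] n)) (divℚ-cancelˡ (lucas n) (fib-pos 0<n))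

-- Finite sums and convergence

sumBelow : (ℕ → ℚ) → ℕ → ℚ
sumBelow g zero = 0ℚ
sumBelow g (suc n) = sumBelow g n +ℚ g n

sum1≡sumBelow : ∀ f N → sum1 f N ≡ sumBelow (λ m → f (suc m)) N
sum1≡sumBelow f zero = refl
sum1≡sumBelow f (suc N) = cong (_+ℚ f (suc N)) (sum1≡sumBelow f N)

sumBelow-cong : ∀ {g h} → (∀ m → g m ≡ h m) → ∀ N → sumBelow g N ≡ sumBelow h N
sumBelow-cong g≗h zero = refl
sumBelow-cong g≗h (suc N) = cong₂ _+ℚ_ (sumBelow-cong g≗h N) (g≗h N)

sumBelow-suc : ∀ h K → sumBelow h (suc K) ≡ h 0 +ℚ sumBelow (λ j → h (suc j)) K
sumBelow-suc h zero = ℚ.+-comm 0ℚ (h 0)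
sumBelow-suc h (suc K) = begin
  sumBelow h (suc K) +ℚ h (suc K)                          ≡⟨ cong (_+ℚ h (suc K)) (sumBelow-suc h K) ⟩
  (h 0 +ℚ sumBelow (λ j → h (suc j)) K) +ℚ h (suc K)       ≡⟨ ℚ.+-assoc (h 0) _ (h (suc K)) ⟩
  h 0 +ℚ sumBelow (λ j → h (suc j)) (suc K)                ∎
  where open ≡-Reasoning

sumBelow-telescope : ∀ G K N →
  sumBelow (λ m → G m -ℚ G (m + K)) N ≡ sumBelow G K -ℚ sumBelow (λ j → G (N + j)) K
sumBelow-telescope G K zero = sym (ℚ.+-inverseʳ (sumBelow G K))
sumBelow-telescope G K (suc N) =
  trans (cong (_+ℚ (G N -ℚ G (N + K))) (sumBelow-telescope G K N))
    (rebalance (sumBelow G K) (window N) (window (suc N)) (G N) (G (N + K)) shift)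
  where
  window : ℕ → ℚ
  window n = sumBelow (λ j → G (n + j)) K
  shift : window N +ℚ G (N + K) ≡ G N +ℚ window (suc N)
  shift = trans (sumBelow-suc (λ j → G (N + j)) K)
    (cong₂ _+ℚ_ (cong G (ℕ.+-identityʳ N)) (sumBelow-cong (λ j → cong G (ℕ.+-suc N j)) K))
  rebalance : ∀ A B B′ g c → B +ℚ c ≡ g +ℚ B′ → (A -ℚ B) +ℚ (g -ℚ c) ≡ A -ℚ B′
  rebalance A B B′ g c eq = begin
    (A -ℚ B) +ℚ (g -ℚ c)   ≡⟨ regroup A B g c ⟩
    A -ℚ (B +ℚ c) +ℚ g      ≡⟨ cong (λ t → A -ℚ t +ℚ g) eq ⟩
    A -ℚ (g +ℚ B′) +ℚ g     ≡⟨ cancel A B′ g ⟩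
    A -ℚ B′                 ∎
    where
    open ≡-Reasoning
    regroup : ∀ A B g c → (A -ℚ B) +ℚ (g -ℚ c) ≡ A -ℚ (B +ℚ c) +ℚ g
    regroup = Ring.solve-∀ ℚ-ring
    cancel : ∀ A B′ g → A -ℚ (g +ℚ B′) +ℚ g ≡ A -ℚ B′
    cancel = Ring.solve-∀ ℚ-ring

sumBelow-pairs : ∀ h k → sumBelow h (2 * k) ≡ sumBelow (λ i → h (2 * i) +ℚ h (suc (2 * i))) k
sumBelow-pairs h zero = refl
sumBelow-pairs h (suc k) = begin
  sumBelow h (2 * suc k)                                          ≡⟨ cong (sumBelow h) (ℕ.*-suc 2 k) ⟩
  sumBelow h (2 * k) +ℚ h (2 * k) +ℚ h (suc (2 * k))              ≡⟨ ℚ.+-assoc (sumBelow h (2 * k)) _ _ ⟩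
  sumBelow h (2 * k) +ℚ (h (2 * k) +ℚ h (suc (2 * k)))            ≡⟨ cong (_+ℚ (h (2 * k) +ℚ h (suc (2 * k)))) (sumBelow-pairs h k) ⟩
  sumBelow (λ i → h (2 * i) +ℚ h (suc (2 * i))) (suc k)           ∎
  where open ≡-Reasoning

*-distribˡ-sumBelow : ∀ c g N → c *ℚ sumBelow g N ≡ sumBelow (λ m → c *ℚ g m) N
*-distribˡ-sumBelow c g zero = ℚ.*-zeroʳ c
*-distribˡ-sumBelow c g (suc N) =
  trans (ℚ.*-distribˡ-+ c (sumBelow g N) (g N)) (cong (_+ℚ c *ℚ g N) (*-distribˡ-sumBelow c g N))

∣sumBelow∣≤sumBelow∣∣ : ∀ g N → ∣ sumBelow g N ∣ ≤ℚ sumBelow (λ m → ∣ g m ∣) N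
∣sumBelow∣≤sumBelow∣∣ g zero = ℚ.≤-refl
∣sumBelow∣≤sumBelow∣∣ g (suc N) =
  ℚ.≤-trans (ℚ.∣p+q∣≤∣p∣+∣q∣ (sumBelow g N) (g N)) (ℚ.+-monoˡ-≤ ∣ g N ∣ (∣sumBelow∣≤sumBelow∣∣ g N))

sumBelow-≤ : ∀ g c N → (∀ m → g m ≤ℚ c) → sumBelow g N ≤ℚ fromℤ (+ N) *ℚ c
sumBelow-≤ g c zero _ = ℚ.≤-reflexive (sym (ℚ.*-zeroˡ c))
sumBelow-≤ g c (suc N) g≤c = ℚ.≤-trans (ℚ.+-mono-≤ (sumBelow-≤ g c N g≤c) (g≤c N)) (ℚ.≤-reflexive (begin
  fromℤ (+ N) *ℚ c +ℚ c         ≡⟨ ℚ.+-comm _ c ⟩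
  c +ℚ fromℤ (+ N) *ℚ c         ≡⟨ cong (_+ℚ fromℤ (+ N) *ℚ c) (sym (ℚ.*-identityˡ c)) ⟩
  1ℚ *ℚ c +ℚ fromℤ (+ N) *ℚ c   ≡⟨ sym (ℚ.*-distribʳ-+ c 1ℚ (fromℤ (+ N))) ⟩
  (1ℚ +ℚ fromℤ (+ N)) *ℚ c      ≡⟨ cong (_*ℚ c) (sym (fromℤ-homo-+ (+ 1) (+ N))) ⟩
  fromℤ (+ suc N) *ℚ c          ∎))
  where open ≡-Reasoning

seriesSumsTo-of-remainder : ∀ f L (R : ℕ → ℚ) C →
  (∀ N → sum1 f N ≡ L -ℚ R N) → (∀ N → ∣ R N ∣ ≤ℚ divℚ (+ C) (suc N)) → SeriesSumsTo f L
seriesSumsTo-of-remainder f L R C partial bound ε 0<ε with archimedean-divℚ C ε 0<ε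
... | N₀ , small = N₀ , λ N N₀≤N → ℚ.≤-<-trans (ℚ.≤-reflexive (error N)) (ℚ.≤-<-trans (bound N) (small N N₀≤N))
  where
  error : ∀ N → ∣ sum1 f N -ℚ L ∣ ≡ ∣ R N ∣
  error N = trans (cong (λ s → ∣ s -ℚ L ∣) (partial N))
    (trans (cong ∣_∣ (cancel L (R N))) (ℚ.∣-p∣≡∣p∣ (R N)))
    where
    cancel : ∀ L R → (L -ℚ R) -ℚ L ≡ -ℚ R
    cancel = Ring.solve-∀ ℚ-ring

-- The series

arithmetic-closed-form : ∀ (u : ℕ → ℕ) r → (∀ n → 1 ≤ n → u (suc n) ≡ u n + r) → ∀ m → u (suc m) ≡ u 1 + m * r
arithmetic-closed-form u r step zero = sym (ℕ.+-identityʳ (u 1))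
arithmetic-closed-form u r step (suc m) = begin
  u (suc (suc m))       ≡⟨ step (suc m) (s≤s z≤n) ⟩
  u (suc m) + r         ≡⟨ cong (_+ r) (arithmetic-closed-form u r step m) ⟩
  u 1 + m * r + r       ≡⟨ shuffle (u 1) m r ⟩
  u 1 + suc m * r       ∎
  where
  open ≡-Reasoning
  shuffle : ∀ a m r → a + m * r + r ≡ a + suc m * r
  shuffle = ℕ-Ring.solve-∀

module FibonacciReciprocals
  (u : ℕ → ℕ) (r′ : ℕ) (0<u₁ : 0 < u 1) (u-closed : ∀ m → u (suc m) ≡ u 1 + m * suc r′) where

  r : ℕ
  r = suc r′

  x : ℕ → ℕ
  x m = u 1 + m * r

  x-suc : ∀ m → x (suc m) ≡ r + x m
  x-suc m = shuffle (u 1) m r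
    where
    shuffle : ∀ a m r → a + suc m * r ≡ r + (a + m * r)
    shuffle = ℕ-Ring.solve-∀

  x-+ : ∀ m s → x (m + s) ≡ s * r + x m
  x-+ m s = shuffle (u 1) m s r
    where
    shuffle : ∀ a m s r → a + (m + s) * r ≡ s * r + (a + m * r)
    shuffle = ℕ-Ring.solve-∀

  suc≤x : ∀ m → suc m ≤ x m
  suc≤x m = ℕ.+-mono-≤ 0<u₁ (ℕ.m≤m*n m r)

  0<fib[x] : ∀ m → 0 < fib (x m)
  0<fib[x] m = fib-pos (ℕ.≤-trans (s≤s z≤n) (suc≤x m))

  Φ ψ ρ ε : ℕ → ℚ
  Φ m = fibℚ (x m)
  ψ m = recip (fib (x m))
  ρ m = Φ (suc m) *ℚ ψ m
  ε m = sign (u 1 + m)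

  Φ*ψ≡1 : ∀ m → Φ m *ℚ ψ m ≡ 1ℚ
  Φ*ψ≡1 m = fromℤ-*-recip (0<fib[x] m)

  fib[x]-vajda : ∀ m s →
    Φ (suc m) *ℚ Φ (m + s) -ℚ Φ m *ℚ Φ (suc (m + s)) ≡ sign (x m) *ℚ fibℚ r *ℚ fibℚ (s * r)
  fib[x]-vajda m s = begin
    Φ (suc m) *ℚ Φ (m + s) -ℚ Φ m *ℚ Φ (suc (m + s))
      ≡⟨ cong₂ (λ i j → fibℚ i *ℚ fibℚ j -ℚ Φ m *ℚ Φ (suc (m + s))) (x-suc m) (x-+ m s) ⟩
    fibℚ (r + x m) *ℚ fibℚ (s * r + x m) -ℚ Φ m *ℚ Φ (suc (m + s))
      ≡⟨ cong (λ i → fibℚ (r + x m) *ℚ fibℚ (s * r + x m) -ℚ Φ m *ℚ fibℚ i) (trans (x-suc (m + s)) (cong (_+_ r) (x-+ m s))) ⟩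
    fibℚ (r + x m) *ℚ fibℚ (s * r + x m) -ℚ Φ m *ℚ fibℚ (r + (s * r + x m))
      ≡⟨ fibℚ-vajda r (s * r) (x m) ⟩
    sign (x m) *ℚ fibℚ r *ℚ fibℚ (s * r)
      ∎
    where open ≡-Reasoning

  ratio-gap : ∀ m s → ρ m -ℚ ρ (m + s) ≡ sign (x m) *ℚ fibℚ r *ℚ fibℚ (s * r) *ℚ (ψ m *ℚ ψ (m + s))
  ratio-gap m s = trans (sub-fractions (Φ (suc m)) (Φ (suc (m + s))) (Φ m) (ψ m) (Φ (m + s)) (ψ (m + s))
    (Φ*ψ≡1 m) (Φ*ψ≡1 (m + s)))
    (cong (_*ℚ (ψ m *ℚ ψ (m + s))) (fib[x]-vajda m s))

  ε*sign[x] : ∀ m → ε m *ℚ sign (x m) ≡ sign (r′ * m)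
  ε*sign[x] m = begin
    ε m *ℚ sign (x m)                   ≡⟨ sym (sign-+ (u 1 + m) (x m)) ⟩
    sign (u 1 + m + x m)                ≡⟨ cong sign (parity (u 1) m r′) ⟩
    sign (r′ * m + 2 * (u 1 + m))       ≡⟨ sign-+-2* (r′ * m) (u 1 + m) ⟩
    sign (r′ * m)                       ∎
    where
    open ≡-Reasoning
    parity : ∀ a m r′ → a + m + (a + m * suc r′) ≡ r′ * m + 2 * (a + m)
    parity = ℕ-Ring.solve-∀

  ε-suc : ∀ m → ε (suc m) ≡ -ℚ ε m
  ε-suc m = trans (cong sign (ℕ.+-suc (u 1) m)) (sign-suc (u 1 + m))

  ε-+-2* : ∀ m k → ε (m + 2 * k) ≡ ε m
  ε-+-2* m k = trans (cong sign (sym (ℕ.+-assoc (u 1) m (2 * k)))) (sign-+-2* (u 1 + m) k)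

  0<fib[r] : 0 < fib r
  0<fib[r] = fib-pos {r} (s≤s z≤n)

  scaled-gap : ∀ K s m → recip (fib r * fib (K * r)) *ℚ (ε m *ℚ (ρ m -ℚ ρ (m + s)))
    ≡ divℚ (+ fib (s * r)) (fib (K * r)) *ℚ (sign (r′ * m) *ℚ (ψ m *ℚ ψ (m + s)))
  scaled-gap K s m = begin
    recip (fib r * fib (K * r)) *ℚ (ε m *ℚ (ρ m -ℚ ρ (m + s)))
      ≡⟨ cong₂ (λ c g → c *ℚ (ε m *ℚ g)) (recip-* (fib r) (fib (K * r))) (ratio-gap m s) ⟩
    recip (fib r) *ℚ recip (fib (K * r)) *ℚ (ε m *ℚ (sign (x m) *ℚ fibℚ r *ℚ fibℚ (s * r) *ℚ Ψ))
      ≡⟨ regroup (recip (fib r)) (recip (fib (K * r))) (ε m) (sign (x m)) (fibℚ r) (fibℚ (s * r)) Ψ ⟩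
    fibℚ r *ℚ recip (fib r) *ℚ (fibℚ (s * r) *ℚ recip (fib (K * r)) *ℚ (ε m *ℚ sign (x m) *ℚ Ψ))
      ≡⟨ cong₂ _*ℚ_ (fromℤ-*-recip 0<fib[r])
           (cong₂ _*ℚ_ (sym (divℚ≡fromℤ*recip (+ fib (s * r)) (fib (K * r)))) (cong (_*ℚ Ψ) (ε*sign[x] m))) ⟩
    1ℚ *ℚ (divℚ (+ fib (s * r)) (fib (K * r)) *ℚ (sign (r′ * m) *ℚ Ψ))
      ≡⟨ ℚ.*-identityˡ _ ⟩
    divℚ (+ fib (s * r)) (fib (K * r)) *ℚ (sign (r′ * m) *ℚ Ψ)
      ∎
    where
    open ≡-Reasoning
    Ψ : ℚ
    Ψ = ψ m *ℚ ψ (m + s)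
    regroup : ∀ i j e σ f g Ψ → i *ℚ j *ℚ (e *ℚ (σ *ℚ f *ℚ g *ℚ Ψ)) ≡ f *ℚ i *ℚ (g *ℚ j *ℚ (e *ℚ σ *ℚ Ψ))
    regroup = Ring.solve-∀ ℚ-ring

  module _ (k : ℕ) where

    summand : ℕ → ℚ
    summand n = divℚ (negOnePow ((r ∸ 1) * (n ∸ 1))) (fib (u n) * fib (u (n + 2 * k)))

    pair-summand : ℕ → ℚ
    pair-summand n = divℚ (+ 1) (fib (u (2 * n)) * fib (u (2 * n ∸ 1)))

    W : ℚ
    W = divℚ (+ fib r) (fib (2 * k * r))

    G q : ℕ → ℚ
    G m = recip (fib r * fib (2 * k * r)) *ℚ (ε m *ℚ ρ m)
    q m = W *ℚ (sign (r′ * m) *ℚ (ψ m *ℚ ψ (suc m)))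

    remainder : ℕ → ℚ
    remainder N = sumBelow (λ j → q (N + 2 * j)) k

    0<fib[2kr] : 0 < k → 0 < fib (2 * k * r)
    0<fib[2kr] 0<k = fib-pos (ℕ.*-mono-< (ℕ.*-mono-< {0} {2} (s≤s z≤n) 0<k) (s≤s z≤n))

    summand-suc : ∀ m → summand (suc m) ≡ sign (r′ * m) *ℚ (ψ m *ℚ ψ (m + 2 * k))
    summand-suc m = begin
      summand (suc m)
        ≡⟨ cong₂ (λ i j → divℚ (negOnePow (r′ * m)) (fib i * fib j)) (u-closed m) (u-closed (m + 2 * k)) ⟩
      divℚ (negOnePow (r′ * m)) (fib (x m) * fib (x (m + 2 * k)))
        ≡⟨ divℚ≡fromℤ*recip (negOnePow (r′ * m)) (fib (x m) * fib (x (m + 2 * k))) ⟩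
      sign (r′ * m) *ℚ recip (fib (x m) * fib (x (m + 2 * k)))
        ≡⟨ cong (sign (r′ * m) *ℚ_) (recip-* (fib (x m)) (fib (x (m + 2 * k)))) ⟩
      sign (r′ * m) *ℚ (ψ m *ℚ ψ (m + 2 * k))
        ∎
      where open ≡-Reasoning

    G-difference : 0 < k → ∀ m → sign (r′ * m) *ℚ (ψ m *ℚ ψ (m + 2 * k)) ≡ G m -ℚ G (m + 2 * k)
    G-difference 0<k m = sym (begin
      G m -ℚ G (m + 2 * k)
        ≡⟨ cong (λ e → G m -ℚ R *ℚ (e *ℚ ρ (m + 2 * k))) (ε-+-2* m k) ⟩
      R *ℚ (ε m *ℚ ρ m) -ℚ R *ℚ (ε m *ℚ ρ (m + 2 * k))
        ≡⟨ factor R (ε m) (ρ m) (ρ (m + 2 * k)) ⟩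
      R *ℚ (ε m *ℚ (ρ m -ℚ ρ (m + 2 * k)))
        ≡⟨ scaled-gap (2 * k) (2 * k) m ⟩
      divℚ (+ fib (2 * k * r)) (fib (2 * k * r)) *ℚ σΨ
        ≡⟨ cong (_*ℚ σΨ) (trans (divℚ≡fromℤ*recip (+ fib (2 * k * r)) (fib (2 * k * r))) (fromℤ-*-recip (0<fib[2kr] 0<k))) ⟩
      1ℚ *ℚ σΨ
        ≡⟨ ℚ.*-identityˡ σΨ ⟩
      σΨ
        ∎)
      where
      open ≡-Reasoning
      R σΨ : ℚ
      R = recip (fib r * fib (2 * k * r))
      σΨ = sign (r′ * m) *ℚ (ψ m *ℚ ψ (m + 2 * k))
      factor : ∀ c e g h → c *ℚ (e *ℚ g) -ℚ c *ℚ (e *ℚ h) ≡ c *ℚ (e *ℚ (g -ℚ h))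
      factor = Ring.solve-∀ ℚ-ring

    G-pair : ∀ m → G m +ℚ G (suc m) ≡ q m
    G-pair m = begin
      G m +ℚ G (suc m)
        ≡⟨ cong (λ e → G m +ℚ R *ℚ (e *ℚ ρ (suc m))) (ε-suc m) ⟩
      R *ℚ (ε m *ℚ ρ m) +ℚ R *ℚ (-ℚ ε m *ℚ ρ (suc m))
        ≡⟨ factor R (ε m) (ρ m) (ρ (suc m)) ⟩
      R *ℚ (ε m *ℚ (ρ m -ℚ ρ (suc m)))
        ≡⟨ cong (λ i → R *ℚ (ε m *ℚ (ρ m -ℚ ρ i))) (ℕ.+-comm 1 m) ⟩
      R *ℚ (ε m *ℚ (ρ m -ℚ ρ (m + 1)))
        ≡⟨ scaled-gap (2 * k) 1 m ⟩
      divℚ (+ fib (1 * r)) (fib (2 * k * r)) *ℚ (sign (r′ * m) *ℚ (ψ m *ℚ ψ (m + 1)))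
        ≡⟨ cong₂ (λ i j → divℚ (+ fib i) (fib (2 * k * r)) *ℚ (sign (r′ * m) *ℚ (ψ m *ℚ ψ j)))
             (ℕ.*-identityˡ r) (ℕ.+-comm m 1) ⟩
      q m
        ∎
      where
      open ≡-Reasoning
      R : ℚ
      R = recip (fib r * fib (2 * k * r))
      factor : ∀ c e g h → c *ℚ (e *ℚ g) +ℚ c *ℚ (-ℚ e *ℚ h) ≡ c *ℚ (e *ℚ (g -ℚ h))
      factor = Ring.solve-∀ ℚ-ring

    partial-sum : 0 < k → ∀ N →
      sum1 summand N ≡ sumBelow (λ j → q (2 * j)) k -ℚ remainder N
    partial-sum 0<k N = begin
      sum1 summand N
        ≡⟨ sum1≡sumBelow summand N ⟩
      sumBelow (λ m → summand (suc m)) N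
        ≡⟨ sumBelow-cong (λ m → trans (summand-suc m) (G-difference 0<k m)) N ⟩
      sumBelow (λ m → G m -ℚ G (m + 2 * k)) N
        ≡⟨ sumBelow-telescope G (2 * k) N ⟩
      sumBelow G (2 * k) -ℚ sumBelow (λ j → G (N + j)) (2 * k)
        ≡⟨ cong₂ _-ℚ_ (paired 0) (paired N) ⟩
      sumBelow (λ j → q (2 * j)) k -ℚ remainder N
        ∎
      where
      open ≡-Reasoning
      paired : ∀ n → sumBelow (λ j → G (n + j)) (2 * k) ≡ sumBelow (λ j → q (n + 2 * j)) k
      paired n = trans (sumBelow-pairs (λ j → G (n + j)) k) (sumBelow-cong
        (λ j → trans (cong (λ i → G (n + 2 * j) +ℚ G i) (ℕ.+-suc n (2 * j))) (G-pair (n + 2 * j))) k)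

    q-even : ∀ j → q (2 * j) ≡ W *ℚ pair-summand (suc j)
    q-even j = begin
      W *ℚ (sign (r′ * (2 * j)) *ℚ (ψ (2 * j) *ℚ ψ (suc (2 * j))))
        ≡⟨ cong (λ σ → W *ℚ (σ *ℚ (ψ (2 * j) *ℚ ψ (suc (2 * j))))) (trans (cong sign (swap r′ j)) (sign-2* (r′ * j))) ⟩
      W *ℚ (1ℚ *ℚ (ψ (2 * j) *ℚ ψ (suc (2 * j))))
        ≡⟨ cong (W *ℚ_) (trans (ℚ.*-identityˡ _) (ℚ.*-comm (ψ (2 * j)) (ψ (suc (2 * j))))) ⟩
      W *ℚ (ψ (suc (2 * j)) *ℚ ψ (2 * j))
        ≡⟨ cong (W *ℚ_) (sym (recip-* (fib (x (suc (2 * j)))) (fib (x (2 * j))))) ⟩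
      W *ℚ recip (fib (x (suc (2 * j))) * fib (x (2 * j)))
        ≡⟨ cong (W *ℚ_) (sym (cong₂ (λ i l → recip (fib i * fib l)) (u-closed (suc (2 * j))) (u-closed (2 * j)))) ⟩
      W *ℚ recip (fib (u (2 + 2 * j)) * fib (u (1 + 2 * j)))
        ≡⟨ cong (λ i → W *ℚ recip (fib (u i) * fib (u (i ∸ 1)))) (sym (ℕ.*-suc 2 j)) ⟩
      W *ℚ pair-summand (suc j)
        ∎
      where
      open ≡-Reasoning
      swap : ∀ r′ j → r′ * (2 * j) ≡ 2 * (r′ * j)
      swap = ℕ-Ring.solve-∀

    even-sum : sumBelow (λ j → q (2 * j)) k ≡ W *ℚ sum1 pair-summand k
    even-sum = begin
      sumBelow (λ j → q (2 * j)) k                    ≡⟨ sumBelow-cong q-even k ⟩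
      sumBelow (λ j → W *ℚ pair-summand (suc j)) k     ≡⟨ sym (*-distribˡ-sumBelow W (λ j → pair-summand (suc j)) k) ⟩
      W *ℚ sumBelow (λ j → pair-summand (suc j)) k     ≡⟨ cong (W *ℚ_) (sym (sum1≡sumBelow pair-summand k)) ⟩
      W *ℚ sum1 pair-summand k                         ∎
      where open ≡-Reasoning

    ∣q∣≤ : 0 < k → ∀ m → ∣ q m ∣ ≤ℚ divℚ (+ fib r) (suc m)
    ∣q∣≤ 0<k m = begin
      ∣ W *ℚ (sign (r′ * m) *ℚ (ψ m *ℚ ψ (suc m))) ∣
        ≡⟨ cong ∣_∣ (regroup W (sign (r′ * m)) (ψ m) (ψ (suc m))) ⟩
      ∣ sign (r′ * m) *ℚ (W *ℚ (ψ m *ℚ ψ (suc m))) ∣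
        ≡⟨ cong (λ t → ∣ sign (r′ * m) *ℚ (W *ℚ t) ∣) (sym (recip-* (fib (x m)) (fib (x (suc m))))) ⟩
      ∣ sign (r′ * m) *ℚ (W *ℚ recip P) ∣
        ≡⟨ cong (λ t → ∣ sign (r′ * m) *ℚ t ∣) W*recip ⟩
      ∣ sign (r′ * m) *ℚ divℚ (+ fib r) (F * P) ∣
        ≡⟨ ℚ.∣p*q∣≡∣p∣*∣q∣ (sign (r′ * m)) (divℚ (+ fib r) (F * P)) ⟩
      ∣ sign (r′ * m) ∣ *ℚ ∣ divℚ (+ fib r) (F * P) ∣
        ≡⟨ cong₂ _*ℚ_ (∣sign∣≡1 (r′ * m)) (ℚ.0≤p⇒∣p∣≡p (divℚ-nonNeg (fib r) (F * P))) ⟩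
      1ℚ *ℚ divℚ (+ fib r) (F * P)
        ≡⟨ ℚ.*-identityˡ _ ⟩
      divℚ (+ fib r) (F * P)
        ≤⟨ divℚ-antimono-≤ (fib r) (s≤s z≤n) suc≤F*P ⟩
      divℚ (+ fib r) (suc m)
        ∎
      where
      open ℚ.≤-Reasoning
      F P : ℕ
      F = fib (2 * k * r)
      P = fib (x m) * fib (x (suc m))
      regroup : ∀ w σ a b → w *ℚ (σ *ℚ (a *ℚ b)) ≡ σ *ℚ (w *ℚ (a *ℚ b))
      regroup = Ring.solve-∀ ℚ-ring
      W*recip : W *ℚ recip P ≡ divℚ (+ fib r) (F * P)
      W*recip = trans (cong (_*ℚ recip P) (divℚ≡fromℤ*recip (+ fib r) F))
        (trans (ℚ.*-assoc (fibℚ r) (recip F) (recip P))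
          (trans (cong (fibℚ r *ℚ_) (sym (recip-* F P))) (sym (divℚ≡fromℤ*recip (+ fib r) (F * P)))))
      suc≤F*P : suc m ≤ F * P
      suc≤F*P = ℕ.≤-trans (n≤fib[n]*fib[1+n] (suc m))
        (ℕ.≤-trans (ℕ.*-mono-≤ (fib-mono-≤ (suc≤x m)) (fib-mono-≤ (suc≤x (suc m))))
          (ℕ.m≤n*m P F {{>-nonZero (0<fib[2kr] 0<k)}}))

    ∣remainder∣≤ : 0 < k → ∀ N → ∣ remainder N ∣ ≤ℚ divℚ (+ (k * fib r)) (suc N)
    ∣remainder∣≤ 0<k N = begin
      ∣ remainder N ∣
        ≤⟨ ∣sumBelow∣≤sumBelow∣∣ (λ j → q (N + 2 * j)) k ⟩
      sumBelow (λ j → ∣ q (N + 2 * j) ∣) k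
        ≤⟨ sumBelow-≤ _ (divℚ (+ fib r) (suc N)) k (λ j → ℚ.≤-trans (∣q∣≤ 0<k (N + 2 * j))
             (divℚ-antimono-≤ (fib r) (s≤s z≤n) (s≤s (ℕ.m≤m+n N (2 * j))))) ⟩
      fromℤ (+ k) *ℚ divℚ (+ fib r) (suc N)
        ≡⟨ fromℤ-*-divℚ (+ k) (+ fib r) (suc N) ⟩
      divℚ (+ k ℤ.* + fib r) (suc N)
        ≡⟨ cong (λ i → divℚ i (suc N)) (sym (ℤ.pos-* k (fib r))) ⟩
      divℚ (+ (k * fib r)) (suc N)
        ∎
      where open ℚ.≤-Reasoning

    summand-sums-to : 0 < k → SeriesSumsTo summand (W *ℚ sum1 pair-summand k)
    summand-sums-to 0<k = seriesSumsTo-of-remainder summand (W *ℚ sum1 pair-summand k) remainder (k * fib r)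
      (λ N → trans (partial-sum 0<k N) (cong (_-ℚ remainder N) even-sum)) (∣remainder∣≤ 0<k)

corollary2p6 : (u : ℕ → ℕ) (r : ℕ)
  → 1 ≤ r
  → (∀ n → 1 ≤ n → 1 ≤ u n)
  → (∀ n → 1 ≤ n → u (suc n) ≡ u n + r)
  → (∀ k → 1 ≤ k →
       SeriesSumsTo
         (λ n → divℚ (negOnePow ((r ∸ 1) * (n ∸ 1))) (fib (u n) * fib (u (n + 2 * k))))
         (divℚ (+ fib r) (fib (2 * k * r))
           *ℚ sum1 (λ n → divℚ (+ 1) (fib (u (2 * n)) * fib (u (2 * n ∸ 1)))) k))
    × SeriesSumsTo
        (λ n → divℚ (negOnePow ((r ∸ 1) * (n ∸ 1))) (fib (u n) * fib (u (n + 2))))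
        (divℚ (+ 1) (fib (u 1) * fib (u 2) * lucas r))
corollary2p6 u (suc r′) (s≤s z≤n) 0<u u-step = summand-sums-to , lucas-case
  where
  open FibonacciReciprocals u r′ (0<u 1 (s≤s z≤n)) (arithmetic-closed-form u (suc r′) u-step)
  A B L : ℕ
  A = fib (u 1)
  B = fib (u 2)
  L = lucas r
  limit : W 1 *ℚ sum1 (pair-summand 1) 1 ≡ recip (A * B * L)
  limit = begin
    W 1 *ℚ (0ℚ +ℚ recip (B * A))           ≡⟨ cong₂ (λ w t → w *ℚ (0ℚ +ℚ t)) (divℚ[fib[n],fib[2n]]≡recip[lucas[n]] {r} (s≤s z≤n))
                                                 (trans (cong recip (ℕ.*-comm B A)) (recip-* A B)) ⟩
    recip L *ℚ (0ℚ +ℚ recip A *ℚ recip B)  ≡⟨ regroup (recip L) (recip A) (recip B) ⟩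
    recip A *ℚ recip B *ℚ recip L          ≡⟨ sym (trans (recip-* (A * B) L) (cong (_*ℚ recip L) (recip-* A B))) ⟩
    recip (A * B * L)                      ∎
    where
    open ≡-Reasoning
    regroup : ∀ l a b → l *ℚ (0ℚ +ℚ a *ℚ b) ≡ a *ℚ b *ℚ l
    regroup = Ring.solve-∀ ℚ-ring
  lucas-case : SeriesSumsTo (summand 1) (recip (A * B * L))
  lucas-case = subst (SeriesSumsTo (summand 1)) limit (summand-sums-to 1 (s≤s z≤n))
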